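{- For all integers $a\ge0$, $$\sum_{N=0}^{\infty}p\!\left(\left\lfloor\tfrac{3N}{2}\right\rfloor-3a,3,N\right)z^N=\frac{z^{2a}\left(1+z^2+z^3-z^{4a+2}\right)}{(1-z)(1-z^2)(1-z^4)},$$ $$\sum_{N=0}^{\infty}p\!\left(\left\lfloor\tfrac{3N}{2}\right\rfloor-(3a+1),3,N\right)z^N=\frac{z^{2a+1}\left(1+z+z^3-z^{4a+3}\right)}{(1-z)(1-z^2)(1-z^4)},$$ $$\sum_{N=0}^{\infty}p\!\left(\left\lfloor\tfrac{3N}{2}\right\rfloor-(3a+2),3,N\right)z^N=\frac{z^{2a+2}\left(1+z+z^2-z^{4a+4}\right)}{(1-z)(1-z^2)(1-z^4)}.$$
   Context: $p(n,m,N)$ is the number of partitions of $n$ into at most $m$ parts, each at most $N$ (equivalently the coefficient of $q^n$ in the Gaussian polynomial $\begin{bmatrix}N+m\\ m\end{bmatrix}_q$); it is $0$ for $n<0$. -}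

module Defs where

open import Data.Nat as ℕ using (ℕ; zero; suc; _∸_; _≟_)
open import Data.Nat.Divisibility using (_∣?_)
open import Data.Nat.DivMod using (_/_)
open import Data.Integer as ℤ using (ℤ; +_; -[1+_])
open import Relation.Nullary.Decidable using (does)
open import Data.Bool using (if_then_else_)

sumTo : ℕ → (ℕ → ℕ) → ℕ
sumTo zero    f = f 0
sumTo (suc N) f = sumTo N f ℕ.+ f (suc N)

-- cnt n m N : number of partitions of n into at most m parts, each ≤ N,
-- i.e. weakly decreasing sequences (λ₁ ≥ … ≥ λₘ) of length m with
-- 0 ≤ λᵢ ≤ N and sum n. Recursion on the largest part λ₁ = k.
cnt : ℕ → ℕ → ℕ → ℕ
cnt n zero    N = if does (n ≟ 0) then 1 else 0
cnt n (suc m) N = sumTo N (λ k → if does (k ℕ.≤? n) then cnt (n ∸ k) m k else 0)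

p : ℤ → ℕ → ℕ → ℕ
p (+ n)    m N = cnt n m N
p -[1+ _ ] m N = 0

Series : Set
Series = ℕ → ℤ

sumTo' : ℕ → (ℕ → ℤ) → ℤ
sumTo' zero    f = f 0
sumTo' (suc n) f = sumTo' n f ℤ.+ f (suc n)

_⊛_ : Series → Series → Series
(f ⊛ g) n = sumTo' n (λ i → f i ℤ.* g (n ∸ i))

_⊕_ : Series → Series → Series
(f ⊕ g) n = f n ℤ.+ g n

_⊖_ : Series → Series → Series
(f ⊖ g) n = f n ℤ.- g n

zpow : ℕ → Series
zpow k n = if does (n ≟ k) then ℤ.1ℤ else ℤ.0ℤ

-- 1/(1 - z^k) for k ≥ 1 (k = suc j): Σ_{t≥0} z^{k t}
geomInv : ℕ → Series
geomInv j n = if does (suc j ∣? n) then ℤ.1ℤ else ℤ.0ℤ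

invDen : Series
invDen = (geomInv 0 ⊛ geomInv 1) ⊛ geomInv 3

fl3N/2 : ℕ → ℕ
fl3N/2 N = (3 ℕ.* N) / 2

module Submission where

-- Write L(c, N) = p(⌊3N/2⌋ - c, 3, N). Counting partitions by their largest part, and removing the
-- first column of those with three nonzero parts, gives the two recurrences
--   L(c + 3, N + 2) = L(c, N) + (⌊N/2⌋ - c)⁺   and   L(c, N + 4) = L(c, N) + N + 4   (2c ≤ N),
-- since every count of partitions into at most two parts that occurs has the closed form ⌊m/2⌋ + 1.
-- The coefficients of the right-hand side obey the same recurrences, because (1 - z⁴) times
-- 1/((1-z)(1-z²)(1-z⁴)) is 1/((1-z)(1-z²)), whose coefficients are again ⌊m/2⌋ + 1. So both sides
-- agree once they agree for a = 0 and small N, which is a finite computation.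

open import Defs
open import Data.Nat using (ℕ; _+_; _*_)
open import Data.Integer using (ℤ; +_; _-_)
open import Data.Product using (_×_)
open import Relation.Binary.PropositionalEquality using (_≡_)

open import Data.Bool using (if_then_else_)
open import Data.Nat using (zero; suc; _∸_; _≤_; _<_; z≤n; s≤s; _≤?_; ⌊_/2⌋; ⌈_/2⌉)
open import Data.Nat.Properties
open import Algebra.Properties.CommutativeSemigroup +-commutativeSemigroup using (interchange)
open import Data.Nat.Divisibility using (divides; _∣?_; ∣m∣n⇒∣m+n; ∣m+n∣m⇒∣n; ∣-refl; 1∣_; ∣⇒≤)
open import Data.Nat.DivMod using (_/_; +-distrib-/-∣ˡ)
open import Data.Nat.Tactic.RingSolver using (solve-∀)
import Data.Integer as Int
import Data.Integer.Properties as Intₚ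
import Data.Integer.Tactic.RingSolver as IntSolver
open import Data.Product using (_,_)
open import Function using (_∘_)
open import Relation.Nullary using (Dec; yes; no; ¬_)
open import Relation.Nullary.Decidable using (does; dec-true; dec-false)
open import Relation.Binary.PropositionalEquality
  using (refl; sym; trans; cong; cong₂; subst; module ≡-Reasoning)
open ≡-Reasoning

guard-yes : ∀ {P A : Set} (d : Dec P) {x y : A} → P → (if does d then x else y) ≡ x
guard-yes d p rewrite dec-true d p = refl

guard-no : ∀ {P A : Set} (d : Dec P) {x y : A} → ¬ P → (if does d then x else y) ≡ y
guard-no d ¬p rewrite dec-false d ¬p = refl

does-⇔ : ∀ {P Q : Set} (p? : Dec P) (q? : Dec Q) → (P → Q) → (Q → P) → does p? ≡ does q?
does-⇔ p? q? to from with q?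
... | yes q = dec-true p? (from q)
... | no ¬q = dec-false p? (¬q ∘ to)

does-suc-≤? : ∀ m n → does (suc m ≤? suc n) ≡ does (m ≤? n)
does-suc-≤? zero    n = refl
does-suc-≤? (suc m) n = refl

sumTo-cong : ∀ N {f g : ℕ → ℕ} → (∀ k → f k ≡ g k) → sumTo N f ≡ sumTo N g
sumTo-cong zero    f≗g = f≗g 0
sumTo-cong (suc N) f≗g = cong₂ _+_ (sumTo-cong N f≗g) (f≗g (suc N))

sumTo-shift : ∀ N (f : ℕ → ℕ) → sumTo (suc N) f ≡ f 0 + sumTo N (λ k → f (suc k))
sumTo-shift zero    f = refl
sumTo-shift (suc N) f = trans (cong (_+ f (2 + N)) (sumTo-shift N f)) (+-assoc (f 0) _ _)

sumTo-+ : ∀ N (f g : ℕ → ℕ) → sumTo N (λ k → f k + g k) ≡ sumTo N f + sumTo N g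
sumTo-+ zero    f g = refl
sumTo-+ (suc N) f g =
  trans (cong (_+ (f (suc N) + g (suc N))) (sumTo-+ N f g))
        (interchange (sumTo N f) (sumTo N g) (f (suc N)) (g (suc N)))

-- Partition counts

cntTop : ℕ → ℕ → ℕ → ℕ
cntTop n m k = if does (k ≤? n) then cnt (n ∸ k) m k else 0

cntTop-≤ : ∀ {k n} m → k ≤ n → cntTop n m k ≡ cnt (n ∸ k) m k
cntTop-≤ {k} {n} m = guard-yes (k ≤? n)

cntTop-> : ∀ {k n} m → n < k → cntTop n m k ≡ 0
cntTop-> {k} {n} m n<k = guard-no (k ≤? n) (<⇒≱ n<k)

cnt-bound-zero : ∀ n m → cnt n m 0 ≡ cnt n 0 0
cnt-bound-zero n zero    = refl
cnt-bound-zero n (suc m) = cnt-bound-zero n m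

cnt-bound-suc : ∀ {n K} m → n ≤ K → cnt n m (suc K) ≡ cnt n m K
cnt-bound-suc zero n≤K = refl
cnt-bound-suc {n} {K} (suc m) n≤K =
  trans (cong (_+_ (cnt n (suc m) K)) (cntTop-> m (s≤s n≤K))) (+-identityʳ _)

cnt-bound-≥ : ∀ {n K} m → n ≤ K → cnt n m K ≡ cnt n m n
cnt-bound-≥ {n} m n≤K with m≤n⇒∃[o]m+o≡n n≤K
... | d , refl = go d
  where
  go : ∀ d → cnt n m (n + d) ≡ cnt n m n
  go zero    = cong (cnt n m) (+-identityʳ n)
  go (suc d) = trans (cong (cnt n m) (+-suc n d)) (trans (cnt-bound-suc m (m≤m+n n d)) (go d))

cnt-one : ∀ n K → cnt n 1 K ≡ (if does (n ≤? K) then 1 else 0)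
cnt-one zero    zero    = refl
cnt-one (suc n) zero    = refl
cnt-one n       (suc K) = trans (cong (_+ cntTop n 0 (suc K)) (cnt-one n K)) (top n K)
  where
  top : ∀ n K → (if does (n ≤? K) then 1 else 0) + cntTop n 0 (suc K)
              ≡ (if does (n ≤? suc K) then 1 else 0)
  top zero          K       = refl
  top (suc zero)    zero    = refl
  top (suc (suc n)) zero    = refl
  top (suc zero)    (suc K) = refl
  top (suc (suc n)) (suc K) = top (suc n) K

cnt-few-parts : ∀ {r m} K → r ≤ m → cnt r (suc m) K ≡ cnt r m K
cnt-few-parts {m = zero} K z≤n = cnt-one 0 K
cnt-few-parts {r} {suc m} K r≤m = sumTo-cong K top
  where
  top : ∀ k → cntTop r (suc m) k ≡ cntTop r m k
  top zero    = refl
  top (suc k) = cong (λ x → if does (suc k ≤? r) then x else 0)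
                     (cnt-few-parts (suc k) (≤-trans (∸-monoˡ-≤ (suc k) r≤m) (m∸n≤m m k)))

-- A partition with exactly suc m nonzero parts loses its first column (one from every part);
-- the others have at most m parts.
cnt-add-column : ∀ m n K → cnt (suc m + n) (suc m) (suc K) ≡ cnt n (suc m) K + cnt (suc m + n) m (suc K)
cnt-add-column zero n K = begin
  cnt (suc n) 1 (suc K)                       ≡⟨ cnt-one (suc n) (suc K) ⟩
  (if does (suc n ≤? suc K) then 1 else 0)    ≡⟨ cong (if_then 1 else 0) (does-suc-≤? n K) ⟩
  (if does (n ≤? K) then 1 else 0)            ≡⟨ sym (cnt-one n K) ⟩
  cnt n 1 K                                   ≡⟨ sym (+-identityʳ _) ⟩
  cnt n 1 K + 0                               ∎
cnt-add-column (suc m) n K = begin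
  cnt (suc Y) (2 + m) (suc K)                                    ≡⟨ peel (suc m) ⟩
  rest (suc m)                                                   ≡⟨ sumTo-cong K column ⟩
  sumTo K (λ k → cntTop n (suc m) k + cntTop (suc Y) m (suc k))  ≡⟨ sumTo-+ K _ _ ⟩
  cnt n (2 + m) K + rest m                                       ≡⟨ cong (_+_ (cnt n (2 + m) K)) (peel m) ⟨
  cnt n (2 + m) K + cnt (suc Y) (suc m) (suc K)                  ∎
  where
  Y = suc m + n
  rest : ℕ → ℕ
  rest m′ = sumTo K (λ k → cntTop (suc Y) m′ (suc k))
  peel : ∀ m′ → cnt (suc Y) (suc m′) (suc K) ≡ rest m′
  peel m′ = trans (sumTo-shift K (cntTop (suc Y) m′)) (cong (_+ rest m′) (cnt-bound-zero (suc Y) m′))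
  column : ∀ k → cntTop (suc Y) (suc m) (suc k) ≡ cntTop n (suc m) k + cntTop (suc Y) m (suc k)
  column k with k ≤? n
  ... | yes k≤n = begin
    cntTop (suc Y) (suc m) (suc k)                 ≡⟨ cntTop-≤ (suc m) (s≤s k≤Y) ⟩
    cnt (Y ∸ k) (suc m) (suc k)                    ≡⟨ cong (λ r → cnt r (suc m) (suc k)) Y∸k ⟩
    cnt (suc m + (n ∸ k)) (suc m) (suc k)          ≡⟨ cnt-add-column m (n ∸ k) k ⟩
    cnt (n ∸ k) (suc m) k + cnt (suc m + (n ∸ k)) m (suc k)
      ≡⟨ cong₂ _+_ (cntTop-≤ (suc m) k≤n)
                   (trans (cntTop-≤ m (s≤s k≤Y)) (cong (λ r → cnt r m (suc k)) Y∸k)) ⟨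
    cntTop n (suc m) k + cntTop (suc Y) m (suc k)  ∎
    where
    k≤Y : k ≤ Y
    k≤Y = ≤-trans k≤n (m≤n+m n (suc m))
    Y∸k : Y ∸ k ≡ suc m + (n ∸ k)
    Y∸k = +-∸-assoc (suc m) k≤n
  ... | no k≰n = trans
    (cong (λ x → if does (suc k ≤? suc Y) then x else 0) (cnt-few-parts (suc k) Y∸k≤m))
    (cong (_+ cntTop (suc Y) m (suc k)) (sym (cntTop-> (suc m) (≰⇒> k≰n))))
    where
    Y∸k≤m : Y ∸ k ≤ m
    Y∸k≤m = ≤-trans (∸-monoʳ-≤ Y (≰⇒> k≰n))
                    (≤-reflexive (trans (cong (_∸ suc n) (sym (+-suc m n))) (m+n∸n≡m m (suc n))))

p12 : ℕ → ℕ
p12 n = suc ⌊ n /2⌋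

p12-pair : ∀ n → p12 n + p12 (suc n) ≡ 2 + n
p12-pair n = cong suc (trans (+-suc ⌊ n /2⌋ ⌈ n /2⌉) (cong suc (⌊n/2⌋+⌈n/2⌉≡n n)))

cnt-two-diagonal : ∀ n → cnt n 2 n ≡ p12 n
cnt-two-diagonal zero          = refl
cnt-two-diagonal (suc zero)    = refl
cnt-two-diagonal (suc (suc n)) = begin
  cnt (2 + n) 2 (2 + n)                    ≡⟨ cnt-add-column 1 n (suc n) ⟩
  cnt n 2 (suc n) + cnt (2 + n) 1 (2 + n)
    ≡⟨ cong₂ _+_ (cnt-bound-≥ 2 (n≤1+n n))
                 (trans (cnt-one (2 + n) (2 + n)) (guard-yes (2 + n ≤? 2 + n) ≤-refl)) ⟩
  cnt n 2 n + 1                            ≡⟨ cong (_+ 1) (cnt-two-diagonal n) ⟩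
  p12 n + 1                                ≡⟨ +-comm (p12 n) 1 ⟩
  p12 (2 + n)                              ∎

cnt-two-≤ : ∀ {n K} → n ≤ K → cnt n 2 K ≡ p12 n
cnt-two-≤ {n} n≤K = trans (cnt-bound-≥ 2 n≤K) (cnt-two-diagonal n)

-- Partitions of 2w + d into two parts at most w + d: the smaller part runs from w to w + ⌊d/2⌋.
cnt-two-≥ : ∀ w d → cnt (w + (w + d)) 2 (w + d) ≡ p12 d
cnt-two-≥ zero    d = cnt-two-diagonal d
cnt-two-≥ (suc w) d = begin
  cnt (suc w + (suc w + d)) 2 (suc w + d)
    ≡⟨ cong (λ n → cnt n 2 (suc w + d)) (cong suc (+-suc w (w + d))) ⟩
  cnt (2 + (w + (w + d))) 2 (suc (w + d))
    ≡⟨ cnt-add-column 1 (w + (w + d)) (w + d) ⟩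
  cnt (w + (w + d)) 2 (w + d) + cnt (2 + (w + (w + d))) 1 (suc (w + d))
    ≡⟨ cong₂ _+_ (cnt-two-≥ w d)
                 (trans (cnt-one (2 + (w + (w + d))) (suc (w + d))) (guard-no (_ ≤? _) too-large)) ⟩
  p12 d + 0
    ≡⟨ +-identityʳ _ ⟩
  p12 d ∎
  where
  too-large : ¬ (2 + (w + (w + d)) ≤ suc (w + d))
  too-large = <⇒≱ (s≤s (s≤s (+-monoʳ-≤ w (m≤n+m d w))))

-- Partitions with largest part K + 1 or K + 2 have at most two more parts, all at most K + 1
-- when n ≤ 2K + 2; there are ⌊w/2⌋ + 1 and ⌈w/2⌉ of them, w = n - K - 1.
cnt-three-top-two : ∀ {n} K → n ≤ suc K + suc K → cnt n 3 (2 + K) ≡ cnt n 3 K + (n ∸ K)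
cnt-three-top-two {n} K n≤ with n ≤? K
... | yes n≤K = begin
  cnt n 3 K + cntTop n 2 (suc K) + cntTop n 2 (2 + K)
    ≡⟨ cong₂ (λ x y → cnt n 3 K + x + y) (cntTop-> 2 (s≤s n≤K)) (cntTop-> 2 (s≤s (m≤n⇒m≤1+n n≤K))) ⟩
  cnt n 3 K + 0 + 0
    ≡⟨ +-identityʳ _ ⟩
  cnt n 3 K + 0
    ≡⟨ cong (_+_ (cnt n 3 K)) (m≤n⇒m∸n≡0 n≤K) ⟨
  cnt n 3 K + (n ∸ K) ∎
... | no n≰K with m≤n⇒∃[o]m+o≡n (≰⇒> n≰K)
...   | w , refl = begin
  cnt n 3 K + cntTop n 2 (suc K) + cntTop n 2 (2 + K)
    ≡⟨ +-assoc (cnt n 3 K) _ _ ⟩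
  cnt n 3 K + (cntTop n 2 (suc K) + cntTop n 2 (2 + K))
    ≡⟨ cong (_+_ (cnt n 3 K)) (top-two w (+-cancelˡ-≤ (suc K) _ _ n≤)) ⟩
  cnt n 3 K + suc w
    ≡⟨ cong (_+_ (cnt n 3 K)) (trans (cong (_∸ K) (sym (+-suc K w))) (m+n∸m≡n K (suc w))) ⟨
  cnt n 3 K + (n ∸ K) ∎
  where
  top-two : ∀ w → w ≤ suc K → cntTop (suc K + w) 2 (suc K) + cntTop (suc K + w) 2 (2 + K) ≡ suc w
  top-two zero w≤ = begin
    cntTop (suc K + 0) 2 (suc K) + cntTop (suc K + 0) 2 (2 + K)
      ≡⟨ cong₂ _+_ (cntTop-≤ 2 (m≤m+n (suc K) 0)) (cntTop-> 2 (s≤s (s≤s (≤-reflexive (+-identityʳ K))))) ⟩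
    cnt (K + 0 ∸ K) 2 (suc K) + 0
      ≡⟨ cong (λ r → cnt r 2 (suc K) + 0) (m+n∸m≡n K 0) ⟩
    cnt 0 2 (suc K) + 0
      ≡⟨ cong (_+ 0) (cnt-two-≤ {K = suc K} z≤n) ⟩
    1 ∎
  top-two (suc w) w≤ = begin
    cntTop (suc K + suc w) 2 (suc K) + cntTop (suc K + suc w) 2 (2 + K)
      ≡⟨ cong₂ _+_ (cntTop-≤ 2 (m≤m+n (suc K) (suc w)))
                   (cntTop-≤ 2 (s≤s (≤-trans (m≤m+n (suc K) w) (≤-reflexive (sym (+-suc K w)))))) ⟩
    cnt (K + suc w ∸ K) 2 (suc K) + cnt (K + suc w ∸ suc K) 2 (2 + K)
      ≡⟨ cong₂ (λ a b → cnt a 2 (suc K) + cnt b 2 (2 + K))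
               (m+n∸m≡n K (suc w)) (trans (cong (_∸ suc K) (+-suc K w)) (m+n∸m≡n K w)) ⟩
    cnt (suc w) 2 (suc K) + cnt w 2 (2 + K)
      ≡⟨ cong₂ _+_ (cnt-two-≤ w≤) (cnt-two-≤ (m≤n⇒m≤1+n (≤-trans (n≤1+n w) w≤))) ⟩
    p12 (suc w) + p12 w
      ≡⟨ +-comm (p12 (suc w)) (p12 w) ⟩
    p12 w + p12 (suc w)
      ≡⟨ p12-pair w ⟩
    suc (suc w) ∎

-- For N ≤ n ≤ ⌊3N/2⌋: two columns are added and two more values of the largest part allowed,
-- and the four closed-form counts sum to N + 4.
cnt-three-step : ∀ {k} N → k ≤ ⌊ N /2⌋ → cnt (6 + (N + k)) 3 (4 + N) ≡ cnt (N + k) 3 N + (4 + N)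
cnt-three-step {k} N k≤ with m≤n⇒∃[o]m+o≡n k+k≤N
  where
  k+k≤N : k + k ≤ N
  k+k≤N = ≤-trans (+-mono-≤ k≤ (≤-trans k≤ (⌊n/2⌋≤⌈n/2⌉ N))) (≤-reflexive (⌊n/2⌋+⌈n/2⌉≡n N))
... | e , refl = begin
  cnt (6 + n) 3 (4 + M)
    ≡⟨ cnt-add-column 2 (3 + n) (3 + M) ⟩
  cnt (3 + n) 3 (3 + M) + cnt (6 + n) 2 (4 + M)
    ≡⟨ cong (_+ cnt (6 + n) 2 (4 + M)) (cnt-add-column 2 n (2 + M)) ⟩
  cnt n 3 (2 + M) + cnt (3 + n) 2 (3 + M) + cnt (6 + n) 2 (4 + M)
    ≡⟨ cong (λ c → c + cnt (3 + n) 2 (3 + M) + cnt (6 + n) 2 (4 + M)) (cnt-three-top-two M n≤) ⟩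
  cnt n 3 M + (n ∸ M) + cnt (3 + n) 2 (3 + M) + cnt (6 + n) 2 (4 + M)
    ≡⟨ cong (λ a → cnt n 3 M + a + cnt (3 + n) 2 (3 + M) + cnt (6 + n) 2 (4 + M)) (m+n∸m≡n M k) ⟩
  cnt n 3 M + k + cnt (3 + n) 2 (3 + M) + cnt (6 + n) 2 (4 + M)
    ≡⟨ cong₂ (λ a b → cnt n 3 M + k + a + b) inner outer ⟩
  cnt n 3 M + k + p12 (3 + x) + p12 (2 + x)
    ≡⟨ regroup (cnt n 3 M) k (p12 x) (p12 (suc x)) ⟩
  cnt n 3 M + (k + (2 + (p12 x + p12 (suc x))))
    ≡⟨ cong (λ y → cnt n 3 M + (k + (2 + y))) (p12-pair x) ⟩
  cnt n 3 M + (k + (2 + (2 + x)))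
    ≡⟨ cong (_+_ (cnt n 3 M)) (total k e) ⟩
  cnt n 3 M + (4 + M) ∎
  where
  M = k + k + e
  n = M + k
  x = k + e
  n≤ : n ≤ suc M + suc M
  n≤ = ≤-trans (+-monoʳ-≤ M (≤-trans (m≤m+n k k) (m≤m+n (k + k) e))) (+-mono-≤ (n≤1+n M) (n≤1+n M))
  inner : cnt (3 + n) 2 (3 + M) ≡ p12 (3 + x)
  inner = trans (cong₂ (λ a b → cnt a 2 b) (shape₁ k e) (shape₂ k e)) (cnt-two-≥ k (3 + x))
    where
    shape₁ : ∀ k e → 3 + (k + k + e + k) ≡ k + (k + (3 + (k + e)))
    shape₁ = solve-∀
    shape₂ : ∀ k e → 3 + (k + k + e) ≡ k + (3 + (k + e))
    shape₂ = solve-∀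
  outer : cnt (6 + n) 2 (4 + M) ≡ p12 (2 + x)
  outer = trans (cong₂ (λ a b → cnt a 2 b) (shape₁ k e) (shape₂ k e)) (cnt-two-≥ (2 + k) (2 + x))
    where
    shape₁ : ∀ k e → 6 + (k + k + e + k) ≡ 2 + k + (2 + k + (2 + (k + e)))
    shape₁ = solve-∀
    shape₂ : ∀ k e → 4 + (k + k + e) ≡ 2 + k + (2 + (k + e))
    shape₂ = solve-∀
  regroup : ∀ c k a b → c + k + suc b + suc a ≡ c + (k + (2 + (a + b)))
  regroup = solve-∀
  total : ∀ k e → k + (2 + (2 + (k + e))) ≡ 4 + (k + k + e)
  total = solve-∀

-- The central coefficients p(⌊3N/2⌋ - c, 3, N)

p-nonneg : ∀ {m c} k N → c ≤ m → p (+ m - + c) k N ≡ cnt (m ∸ c) k N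
p-nonneg {m} {c} k N c≤m = cong (λ z → p z k N) (trans (Intₚ.m-n≡m⊖n m c) (Intₚ.⊖-≥ c≤m))

p-neg : ∀ {m c} k N → m < c → p (+ m - + c) k N ≡ 0
p-neg {m} k N m<c with m≤n⇒∃[o]m+o≡n m<c
... | o , refl = cong (λ z → p z k N) (begin
  + m - + (suc m + o)      ≡⟨ Intₚ.m-n≡m⊖n m (suc m + o) ⟩
  m Int.⊖ (suc m + o)      ≡⟨ Intₚ.⊖-< m<c ⟩
  Int.- + (suc m + o ∸ m)  ≡⟨ cong (λ d → Int.- + d) (trans (cong (_∸ m) (sym (+-suc m o))) (m+n∸m≡n m (suc o))) ⟩
  Int.-[1+ o ]             ∎)

fl3N/2-step : ∀ N → fl3N/2 (2 + N) ≡ 3 + fl3N/2 N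
fl3N/2-step N = trans (cong (_/ 2) (*-distribˡ-+ 3 2 N)) (+-distrib-/-∣ˡ (3 * N) {2} (divides 3 refl))

fl3N/2≡ : ∀ N → fl3N/2 N ≡ N + ⌊ N /2⌋
fl3N/2≡ zero          = refl
fl3N/2≡ (suc zero)    = refl
fl3N/2≡ (suc (suc N)) = begin
  fl3N/2 (2 + N)             ≡⟨ fl3N/2-step N ⟩
  3 + fl3N/2 N               ≡⟨ cong (λ m → 3 + m) (fl3N/2≡ N) ⟩
  3 + (N + ⌊ N /2⌋)          ≡⟨ cong (λ m → 2 + m) (+-suc N ⌊ N /2⌋) ⟨
  2 + N + ⌊ 2 + N /2⌋        ∎

-- ⌊3N/2⌋ is the centre of the Gaussian polynomial [N+3 choose 3]_q, whose degree is 3N.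
central : ℕ → ℕ → ℕ
central c N = p (+ fl3N/2 N - + c) 3 N

central-cnt : ∀ {c} N → c ≤ N + ⌊ N /2⌋ → central c N ≡ cnt (N + ⌊ N /2⌋ ∸ c) 3 N
central-cnt {c} N c≤ = trans (cong (λ m → p (+ m - + c) 3 N) (fl3N/2≡ N)) (p-nonneg 3 N c≤)

central-neg : ∀ {c} N → N + ⌊ N /2⌋ < c → central c N ≡ 0
central-neg {c} N <c = trans (cong (λ m → p (+ m - + c) 3 N) (fl3N/2≡ N)) (p-neg 3 N <c)

-- ⌊3(N+2)/2⌋ - (c+3) = ⌊3N/2⌋ - c, so only the new largest parts N + 1 and N + 2 contribute.
central-lift : ∀ c N → central (3 + c) (2 + N) ≡ central c N + (⌊ N /2⌋ ∸ c)
central-lift c N with c ≤? N + ⌊ N /2⌋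
... | yes c≤F = begin
  central (3 + c) (2 + N)
    ≡⟨ central-cnt (2 + N) (s≤s (s≤s (≤-trans (s≤s c≤F) (≤-reflexive (sym (+-suc N h)))))) ⟩
  cnt (N + suc h ∸ suc c) 3 (2 + N)
    ≡⟨ cong (λ m → cnt (m ∸ suc c) 3 (2 + N)) (+-suc N h) ⟩
  cnt (N + h ∸ c) 3 (2 + N)
    ≡⟨ cnt-three-top-two N (≤-trans (m∸n≤m (N + h) c) (+-mono-≤ (n≤1+n N) (m≤n⇒m≤1+n (⌊n/2⌋≤n N)))) ⟩
  cnt (N + h ∸ c) 3 N + (N + h ∸ c ∸ N)
    ≡⟨ cong₂ _+_ (central-cnt N c≤F) excess ⟨
  central c N + (h ∸ c) ∎
  where
  h = ⌊ N /2⌋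
  excess : h ∸ c ≡ N + h ∸ c ∸ N
  excess = sym (begin
    N + h ∸ c ∸ N    ≡⟨ ∸-+-assoc (N + h) c N ⟩
    N + h ∸ (c + N)  ≡⟨ cong (λ m → N + h ∸ m) (+-comm c N) ⟩
    N + h ∸ (N + c)  ≡⟨ [m+n]∸[m+o]≡n∸o N h c ⟩
    h ∸ c            ∎)
... | no c≰F = begin
  central (3 + c) (2 + N)  ≡⟨ central-neg (2 + N) (s≤s (s≤s (s≤s (≤-trans (≤-reflexive (+-suc N h)) F<c)))) ⟩
  0                        ≡⟨ cong₂ _+_ (central-neg N F<c) (m≤n⇒m∸n≡0 (≤-trans (m≤n+m h N) (<⇒≤ F<c))) ⟨
  central c N + (h ∸ c)    ∎
  where
  h = ⌊ N /2⌋
  F<c : N + h < c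
  F<c = ≰⇒> c≰F

central-step4 : ∀ {c} N → c ≤ ⌊ N /2⌋ → central c (4 + N) ≡ central c N + (4 + N)
central-step4 {c} N c≤h = begin
  central c (4 + N)
    ≡⟨ central-cnt (4 + N) (≤-trans c≤h (≤-trans (m≤n+m h 2) (m≤n+m (2 + h) (4 + N)))) ⟩
  cnt (4 + N + (2 + h) ∸ c) 3 (4 + N)
    ≡⟨ cong (λ m → cnt m 3 (4 + N)) position ⟩
  cnt (6 + (N + (h ∸ c))) 3 (4 + N)
    ≡⟨ cnt-three-step N (m∸n≤m h c) ⟩
  cnt (N + (h ∸ c)) 3 N + (4 + N)
    ≡⟨ cong (λ m → cnt m 3 N + (4 + N)) (+-∸-assoc N c≤h) ⟨
  cnt (N + h ∸ c) 3 N + (4 + N)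
    ≡⟨ cong (_+ (4 + N)) (central-cnt N (≤-trans c≤h (m≤n+m h N))) ⟨
  central c N + (4 + N) ∎
  where
  h = ⌊ N /2⌋
  position : 4 + N + (2 + h) ∸ c ≡ 6 + (N + (h ∸ c))
  position = begin
    4 + N + (2 + h) ∸ c   ≡⟨ cong (_∸ c) (regroup N h) ⟩
    6 + (N + h) ∸ c       ≡⟨ +-∸-assoc 6 (≤-trans c≤h (m≤n+m h N)) ⟩
    6 + (N + h ∸ c)       ≡⟨ cong (λ m → 6 + m) (+-∸-assoc N c≤h) ⟩
    6 + (N + (h ∸ c))     ∎
    where
    regroup : ∀ N h → 4 + N + (2 + h) ≡ 6 + (N + h)
    regroup = solve-∀

-- Shifted sequences and partitions into parts 1, 2, 4

-- shift x f is the coefficient sequence of z^x · Σ f(n) z^n.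
shift : ℕ → (ℕ → ℕ) → ℕ → ℕ
shift zero    f N       = f N
shift (suc x) f zero    = 0
shift (suc x) f (suc N) = shift x f N

shift-cong : ∀ x {f g : ℕ → ℕ} → (∀ n → f n ≡ g n) → ∀ N → shift x f N ≡ shift x g N
shift-cong zero    f≗g N       = f≗g N
shift-cong (suc x) f≗g zero    = refl
shift-cong (suc x) f≗g (suc N) = shift-cong x f≗g N

shift-+ : ∀ x (f g : ℕ → ℕ) N → shift x (λ n → f n + g n) N ≡ shift x f N + shift x g N
shift-+ zero    f g N       = refl
shift-+ (suc x) f g zero    = refl
shift-+ (suc x) f g (suc N) = shift-+ x f g N

shift-shift : ∀ x y f N → shift x (shift y f) N ≡ shift (x + y) f N
shift-shift zero    y f N       = refl
shift-shift (suc x) y f zero    = refl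
shift-shift (suc x) y f (suc N) = shift-shift x y f N

shift-p12-even : ∀ c N → shift (2 + 2 * c) p12 N ≡ ⌊ N /2⌋ ∸ c
shift-p12-even zero    zero          = refl
shift-p12-even zero    (suc zero)    = refl
shift-p12-even zero    (suc (suc N)) = refl
shift-p12-even (suc c) zero          = refl
shift-p12-even (suc c) (suc zero)    = refl
shift-p12-even (suc c) (suc (suc N)) rewrite *-suc 2 c = shift-p12-even c N

-- Partitions of n into parts 1, 2 and 4: the coefficients of 1/((1-z)(1-z²)(1-z⁴)).
p124 : ℕ → ℕ
p124 (suc (suc (suc (suc n)))) = p124 n + p12 (4 + n)
p124 n                         = p12 n

p124-rec : ∀ n → p124 n ≡ shift 4 p124 n + p12 n
p124-rec (suc (suc (suc (suc n)))) = refl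
p124-rec zero                      = refl
p124-rec (suc zero)                = refl
p124-rec (suc (suc zero))          = refl
p124-rec (suc (suc (suc zero)))    = refl

shift-p124 : ∀ x N → shift x p124 N ≡ shift (4 + x) p124 N + shift x p12 N
shift-p124 x N = begin
  shift x p124 N                                   ≡⟨ shift-cong x p124-rec N ⟩
  shift x (λ n → shift 4 p124 n + p12 n) N         ≡⟨ shift-+ x (shift 4 p124) p12 N ⟩
  shift x (shift 4 p124) N + shift x p12 N         ≡⟨ cong (_+ shift x p12 N) (shift-shift x 4 p124 N) ⟩
  shift (x + 4) p124 N + shift x p12 N             ≡⟨ cong (λ y → shift y p124 N + shift x p12 N) (+-comm x 4) ⟩
  shift (4 + x) p124 N + shift x p12 N             ∎

-- The coefficient of z^N in the theorem for c, with numerator z^x₁ + z^x₂ + z^x₃ - z^(2c+2)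
-- and the negative term moved to the left.
CentralIdentity : ℕ → ℕ → ℕ → ℕ → ℕ → Set
CentralIdentity c x₁ x₂ x₃ N =
  central c N + shift (2 + 2 * c) p124 N ≡ shift x₁ p124 N + shift x₂ p124 N + shift x₃ p124 N

identity-lift : ∀ {c x₁ x₂ x₃} → (∀ N → CentralIdentity c x₁ x₂ x₃ N) →
                ∀ N → CentralIdentity (3 + c) (2 + x₁) (2 + x₂) (2 + x₃) N
identity-lift h zero          = refl
identity-lift h (suc zero)    = refl
identity-lift {c} {x₁} {x₂} {x₃} h (suc (suc N)) = begin
  central (3 + c) (2 + N) + shift (2 * (3 + c)) p124 N
    ≡⟨ cong₂ _+_ (central-lift c N) (cong (λ y → shift y p124 N) (*-distribˡ-+ 2 3 c)) ⟩
  central c N + (⌊ N /2⌋ ∸ c) + shift (4 + z) p124 N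
    ≡⟨ +-assoc (central c N) _ _ ⟩
  central c N + ((⌊ N /2⌋ ∸ c) + shift (4 + z) p124 N)
    ≡⟨ cong (_+_ (central c N)) (+-comm _ (shift (4 + z) p124 N)) ⟩
  central c N + (shift (4 + z) p124 N + (⌊ N /2⌋ ∸ c))
    ≡⟨ cong (λ y → central c N + (shift (4 + z) p124 N + y)) (shift-p12-even c N) ⟨
  central c N + (shift (4 + z) p124 N + shift z p12 N)
    ≡⟨ cong (_+_ (central c N)) (shift-p124 z N) ⟨
  central c N + shift z p124 N
    ≡⟨ h N ⟩
  shift x₁ p124 N + shift x₂ p124 N + shift x₃ p124 N ∎
  where
  z = 2 + 2 * c

identity-step4 : ∀ {c x₁ x₂ x₃ N} → c ≤ ⌊ N /2⌋ →
  4 + N + shift (2 + 2 * c) p12 (4 + N) ≡ shift x₁ p12 (4 + N) + shift x₂ p12 (4 + N) + shift x₃ p12 (4 + N) →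
  CentralIdentity c x₁ x₂ x₃ N → CentralIdentity c x₁ x₂ x₃ (4 + N)
identity-step4 {c} {x₁} {x₂} {x₃} {N} c≤ increments identity = begin
  central c (4 + N) + shift z p124 (4 + N)
    ≡⟨ cong₂ _+_ (central-step4 N c≤) (shift-p124 z (4 + N)) ⟩
  (central c N + (4 + N)) + (shift z p124 N + shift z p12 (4 + N))
    ≡⟨ interchange (central c N) (4 + N) _ _ ⟩
  (central c N + shift z p124 N) + (4 + N + shift z p12 (4 + N))
    ≡⟨ cong₂ _+_ identity increments ⟩
  (D x₁ + D x₂ + D x₃) + (H x₁ + H x₂ + H x₃)
    ≡⟨ interchange (D x₁ + D x₂) (D x₃) (H x₁ + H x₂) (H x₃) ⟩
  (D x₁ + D x₂) + (H x₁ + H x₂) + (D x₃ + H x₃)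
    ≡⟨ cong (_+ (D x₃ + H x₃)) (interchange (D x₁) (D x₂) (H x₁) (H x₂)) ⟩
  (D x₁ + H x₁) + (D x₂ + H x₂) + (D x₃ + H x₃)
    ≡⟨ cong₂ _+_ (cong₂ _+_ (shift-p124 x₁ (4 + N)) (shift-p124 x₂ (4 + N))) (shift-p124 x₃ (4 + N)) ⟨
  shift x₁ p124 (4 + N) + shift x₂ p124 (4 + N) + shift x₃ p124 (4 + N) ∎
  where
  z = 2 + 2 * c
  D H : ℕ → ℕ
  D x = shift x p124 N
  H x = shift x p12 (4 + N)

increments₀ : ∀ N → 4 + N + p12 (2 + N) ≡ p12 (4 + N) + p12 (2 + N) + p12 (1 + N)
increments₀ N = begin
  2 + (2 + N) + p12 (2 + N)                    ≡⟨ cong (λ m → 2 + m + p12 (2 + N)) (p12-pair N) ⟨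
  2 + (p12 N + p12 (1 + N)) + p12 (2 + N)      ≡⟨ regroup (p12 N) (p12 (1 + N)) (p12 (2 + N)) ⟩
  p12 (4 + N) + p12 (2 + N) + p12 (1 + N)      ∎
  where
  regroup : ∀ a b c → 2 + (a + b) + c ≡ 2 + a + c + b
  regroup = solve-∀

increments₁ : ∀ N → 4 + N + p12 N ≡ p12 (3 + N) + p12 (2 + N) + p12 N
increments₁ N = cong (_+ p12 N) (begin
  2 + (2 + N)                    ≡⟨ cong (λ m → 2 + m) (p12-pair N) ⟨
  2 + (p12 N + p12 (1 + N))      ≡⟨ regroup (p12 N) (p12 (1 + N)) ⟩
  p12 (3 + N) + p12 (2 + N)      ∎)
  where
  regroup : ∀ a b → 2 + (a + b) ≡ suc b + suc a
  regroup = solve-∀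

increments₂ : ∀ N → 8 + N + p12 (2 + N) ≡ p12 (6 + N) + p12 (5 + N) + p12 (4 + N)
increments₂ N = begin
  6 + (2 + N) + p12 (2 + N)                    ≡⟨ cong (λ m → 6 + m + p12 (2 + N)) (p12-pair N) ⟨
  6 + (p12 N + p12 (1 + N)) + p12 (2 + N)      ≡⟨ regroup (p12 N) (p12 (1 + N)) (p12 (2 + N)) ⟩
  p12 (6 + N) + p12 (5 + N) + p12 (4 + N)      ∎
  where
  regroup : ∀ a b c → 6 + (a + b) + c ≡ 2 + c + (2 + b) + (2 + a)
  regroup = solve-∀

identity₀ : ∀ N → CentralIdentity 0 0 2 3 N
identity₀ 0 = refl
identity₀ 1 = refl
identity₀ 2 = refl
identity₀ 3 = refl
identity₀ (suc (suc (suc (suc N)))) = identity-step4 {x₁ = 0} {2} {3} z≤n (increments₀ N) (identity₀ N)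

identity₁ : ∀ N → CentralIdentity 1 1 2 4 N
identity₁ 0 = refl
identity₁ 1 = refl
identity₁ 2 = refl
identity₁ 3 = refl
identity₁ 4 = refl
identity₁ 5 = refl
identity₁ (suc (suc (suc (suc N@(suc (suc _)))))) =
  identity-step4 {x₁ = 1} {2} {4} (s≤s z≤n) (increments₁ N) (identity₁ N)

identity₂ : ∀ N → CentralIdentity 2 2 3 4 N
identity₂ 0 = refl
identity₂ 1 = refl
identity₂ 2 = refl
identity₂ 3 = refl
identity₂ 4 = refl
identity₂ 5 = refl
identity₂ 6 = refl
identity₂ 7 = refl
identity₂ (suc (suc (suc (suc N@(suc (suc (suc (suc M)))))))) =
  identity-step4 {x₁ = 2} {3} {4} (s≤s (s≤s z≤n)) (increments₂ M) (identity₂ N)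

identity-cast : ∀ {c x₁ x₂ x₃ c′ y₁ y₂ y₃ N} → c ≡ c′ → x₁ ≡ y₁ → x₂ ≡ y₂ → x₃ ≡ y₃ →
  CentralIdentity c x₁ x₂ x₃ N → CentralIdentity c′ y₁ y₂ y₃ N
identity-cast refl refl refl refl identity = identity

identity-iterate : ∀ j x₁ x₂ x₃ → (∀ N → CentralIdentity j x₁ x₂ x₃ N) →
  ∀ a N → CentralIdentity (3 * a + j) (2 * a + x₁) (2 * a + x₂) (2 * a + x₃) N
identity-iterate j x₁ x₂ x₃ h zero          = h
identity-iterate j x₁ x₂ x₃ h (suc a) N =
  identity-cast {N = N} (suc-step 3 j) (suc-step 2 x₁) (suc-step 2 x₂) (suc-step 2 x₃)
                (identity-lift (identity-iterate j x₁ x₂ x₃ h a) N)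
  where
  suc-step : ∀ k x → k + (k * a + x) ≡ k * suc a + x
  suc-step k x = sym (trans (cong (_+ x) (*-suc k a)) (+-assoc k (k * a) x))

-- Formal power series

sumTo'-cong : ∀ n {f g : ℕ → ℤ} → (∀ i → i ≤ n → f i ≡ g i) → sumTo' n f ≡ sumTo' n g
sumTo'-cong zero    f≗g = f≗g 0 z≤n
sumTo'-cong (suc n) f≗g =
  cong₂ Int._+_ (sumTo'-cong n (λ i i≤n → f≗g i (m≤n⇒m≤1+n i≤n))) (f≗g (suc n) ≤-refl)

sumTo'-zero : ∀ n {f : ℕ → ℤ} → (∀ i → i ≤ n → f i ≡ Int.0ℤ) → sumTo' n f ≡ Int.0ℤ
sumTo'-zero zero    f≗0 = f≗0 0 z≤n
sumTo'-zero (suc n) f≗0 =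
  cong₂ Int._+_ (sumTo'-zero n (λ i i≤n → f≗0 i (m≤n⇒m≤1+n i≤n))) (f≗0 (suc n) ≤-refl)

sumTo'-last : ∀ n {f : ℕ → ℤ} → (∀ i → i < n → f i ≡ Int.0ℤ) → sumTo' n f ≡ f n
sumTo'-last zero        f≗0 = refl
sumTo'-last (suc n) {f} f≗0 =
  trans (cong (Int._+ f (suc n)) (sumTo'-zero n (λ i i≤n → f≗0 i (s≤s i≤n)))) (Intₚ.+-identityˡ (f (suc n)))

sumTo'-shift : ∀ n (f : ℕ → ℤ) → sumTo' (suc n) f ≡ f 0 Int.+ sumTo' n (λ i → f (suc i))
sumTo'-shift zero    f = refl
sumTo'-shift (suc n) f = trans (cong (Int._+ f (2 + n)) (sumTo'-shift n f)) (Intₚ.+-assoc (f 0) _ _)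

sumTo'-split : ∀ j n (f : ℕ → ℤ) → sumTo' (suc j + n) f ≡ sumTo' n f Int.+ sumTo' j (λ t → f (suc t + n))
sumTo'-split zero    n f = refl
sumTo'-split (suc j) n f =
  trans (cong (Int._+ f (2 + j + n)) (sumTo'-split j n f)) (Intₚ.+-assoc (sumTo' n f) _ _)

sumTo'-+ : ∀ n (f g : ℕ → ℤ) → sumTo' n (λ i → f i Int.+ g i) ≡ sumTo' n f Int.+ sumTo' n g
sumTo'-+ zero    f g = refl
sumTo'-+ (suc n) f g = trans (cong (Int._+ (f (suc n) Int.+ g (suc n))) (sumTo'-+ n f g))
                             (regroup (sumTo' n f) (sumTo' n g) (f (suc n)) (g (suc n)))
  where
  regroup : ∀ a b c d → a Int.+ b Int.+ (c Int.+ d) ≡ a Int.+ c Int.+ (b Int.+ d)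
  regroup = IntSolver.solve-∀

sumTo'-- : ∀ n (f g : ℕ → ℤ) → sumTo' n (λ i → f i - g i) ≡ sumTo' n f - sumTo' n g
sumTo'-- zero    f g = refl
sumTo'-- (suc n) f g = trans (cong (Int._+ (f (suc n) - g (suc n))) (sumTo'-- n f g))
                             (regroup (sumTo' n f) (sumTo' n g) (f (suc n)) (g (suc n)))
  where
  regroup : ∀ a b c d → a - b Int.+ (c - d) ≡ a Int.+ c - (b Int.+ d)
  regroup = IntSolver.solve-∀

⊛-congˡ : ∀ {f g : Series} h n → (∀ i → f i ≡ g i) → (f ⊛ h) n ≡ (g ⊛ h) n
⊛-congˡ h n f≗g = sumTo'-cong n (λ i _ → cong (Int._* h (n ∸ i)) (f≗g i))

⊛-distribʳ-⊕ : ∀ f g h n → ((f ⊕ g) ⊛ h) n ≡ (f ⊛ h) n Int.+ (g ⊛ h) n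
⊛-distribʳ-⊕ f g h n = trans (sumTo'-cong n (λ i _ → Intₚ.*-distribʳ-+ (h (n ∸ i)) (f i) (g i)))
                             (sumTo'-+ n (λ i → f i Int.* h (n ∸ i)) (λ i → g i Int.* h (n ∸ i)))

⊛-distribʳ-⊖ : ∀ f g h n → ((f ⊖ g) ⊛ h) n ≡ (f ⊛ h) n - (g ⊛ h) n
⊛-distribʳ-⊖ f g h n = trans (sumTo'-cong n (λ i _ → distrib (f i) (g i) (h (n ∸ i))))
                             (sumTo'-- n (λ i → f i Int.* h (n ∸ i)) (λ i → g i Int.* h (n ∸ i)))
  where
  distrib : ∀ a b c → (a - b) Int.* c ≡ a Int.* c - b Int.* c
  distrib = IntSolver.solve-∀

⊛-distribˡ-⊕ : ∀ f g h n → (f ⊛ (g ⊕ h)) n ≡ (f ⊛ g) n Int.+ (f ⊛ h) n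
⊛-distribˡ-⊕ f g h n = trans (sumTo'-cong n (λ i _ → Intₚ.*-distribˡ-+ (f i) (g (n ∸ i)) (h (n ∸ i))))
                             (sumTo'-+ n (λ i → f i Int.* g (n ∸ i)) (λ i → f i Int.* h (n ∸ i)))

⊛-distribˡ-⊖ : ∀ f g h n → (f ⊛ (g ⊖ h)) n ≡ (f ⊛ g) n - (f ⊛ h) n
⊛-distribˡ-⊖ f g h n = trans (sumTo'-cong n (λ i _ → distrib (f i) (g (n ∸ i)) (h (n ∸ i))))
                             (sumTo'-- n (λ i → f i Int.* g (n ∸ i)) (λ i → f i Int.* h (n ∸ i)))
  where
  distrib : ∀ a b c → a Int.* (b - c) ≡ a Int.* b - a Int.* c
  distrib = IntSolver.solve-∀

zpow-zero-⊛ : ∀ f n → (zpow 0 ⊛ f) n ≡ f n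
zpow-zero-⊛ f zero    = Intₚ.*-identityˡ (f 0)
zpow-zero-⊛ f (suc n) = begin
  (zpow 0 ⊛ f) (suc n)
    ≡⟨ sumTo'-shift n (λ i → zpow 0 i Int.* f (suc n ∸ i)) ⟩
  Int.1ℤ Int.* f (suc n) Int.+ sumTo' n (λ i → Int.0ℤ Int.* f (n ∸ i))
    ≡⟨ cong₂ Int._+_ (Intₚ.*-identityˡ (f (suc n))) (sumTo'-zero n (λ i _ → Intₚ.*-zeroˡ (f (n ∸ i)))) ⟩
  f (suc n) Int.+ Int.0ℤ
    ≡⟨ Intₚ.+-identityʳ (f (suc n)) ⟩
  f (suc n) ∎

zpow-suc-⊛-zero : ∀ s f → (zpow (suc s) ⊛ f) 0 ≡ Int.0ℤ
zpow-suc-⊛-zero s f = Intₚ.*-zeroˡ (f 0)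

zpow-suc-⊛-suc : ∀ s f n → (zpow (suc s) ⊛ f) (suc n) ≡ (zpow s ⊛ f) n
zpow-suc-⊛-suc s f n = begin
  (zpow (suc s) ⊛ f) (suc n)
    ≡⟨ sumTo'-shift n (λ i → zpow (suc s) i Int.* f (suc n ∸ i)) ⟩
  Int.0ℤ Int.* f (suc n) Int.+ (zpow s ⊛ f) n
    ≡⟨ cong (Int._+ (zpow s ⊛ f) n) (Intₚ.*-zeroˡ (f (suc n))) ⟩
  Int.0ℤ Int.+ (zpow s ⊛ f) n
    ≡⟨ Intₚ.+-identityˡ _ ⟩
  (zpow s ⊛ f) n ∎

zpow-⊛-zpow : ∀ s e i → (zpow s ⊛ zpow e) i ≡ zpow (s + e) i
zpow-⊛-zpow zero    e i       = zpow-zero-⊛ (zpow e) i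
zpow-⊛-zpow (suc s) e zero    = zpow-suc-⊛-zero s (zpow e)
zpow-⊛-zpow (suc s) e (suc i) = trans (zpow-suc-⊛-suc s (zpow e) i) (zpow-⊛-zpow s e i)

zpow-⊛-shift : ∀ x {F : Series} {f : ℕ → ℕ} → (∀ n → F n ≡ + f n) →
               ∀ N → (zpow x ⊛ F) N ≡ + shift x f N
zpow-⊛-shift zero    {F} F≗f N       = trans (zpow-zero-⊛ F N) (F≗f N)
zpow-⊛-shift (suc x) {F} F≗f zero    = zpow-suc-⊛-zero x F
zpow-⊛-shift (suc x) {F} F≗f (suc N) = trans (zpow-suc-⊛-suc x F N) (zpow-⊛-shift x F≗f N)

geomInv-periodic : ∀ j m → geomInv j (suc j + m) ≡ geomInv j m
geomInv-periodic j m = cong (if_then Int.1ℤ else Int.0ℤ)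
  (does-⇔ (suc j ∣? (suc j + m)) (suc j ∣? m) (λ d → ∣m+n∣m⇒∣n d ∣-refl) (∣m∣n⇒∣m+n ∣-refl))

geomInv-vanishes : ∀ {j r} → suc r ≤ j → geomInv j (suc r) ≡ Int.0ℤ
geomInv-vanishes {j} {r} r<j = guard-no (suc j ∣? suc r) (λ d → <⇒≱ (s≤s r<j) (∣⇒≤ d))

⊛-geomInv : ∀ j f n → (f ⊛ geomInv j) (suc j + n) ≡ (f ⊛ geomInv j) n Int.+ f (suc j + n)
⊛-geomInv j f n = begin
  sumTo' (suc j + n) F
    ≡⟨ sumTo'-split j n F ⟩
  sumTo' n F Int.+ sumTo' j (λ t → F (suc t + n))
    ≡⟨ cong₂ Int._+_ (sumTo'-cong n periodic) (sumTo'-last j vanish) ⟩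
  (f ⊛ geomInv j) n Int.+ f (suc j + n) Int.* geomInv j (suc j + n ∸ (suc j + n))
    ≡⟨ cong (λ m → (f ⊛ geomInv j) n Int.+ f (suc j + n) Int.* geomInv j m) (n∸n≡0 (suc j + n)) ⟩
  (f ⊛ geomInv j) n Int.+ f (suc j + n) Int.* Int.1ℤ
    ≡⟨ cong (Int._+_ ((f ⊛ geomInv j) n)) (Intₚ.*-identityʳ (f (suc j + n))) ⟩
  (f ⊛ geomInv j) n Int.+ f (suc j + n) ∎
  where
  F : ℕ → ℤ
  F i = f i Int.* geomInv j (suc j + n ∸ i)
  periodic : ∀ i → i ≤ n → F i ≡ f i Int.* geomInv j (n ∸ i)
  periodic i i≤n = cong (Int._*_ (f i))
    (trans (cong (geomInv j) (+-∸-assoc (suc j) i≤n)) (geomInv-periodic j (n ∸ i)))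
  vanish : ∀ t → t < j → F (suc t + n) ≡ Int.0ℤ
  vanish t t<j = begin
    F (suc t + n)                                    ≡⟨ cong (λ m → f (suc t + n) Int.* geomInv j m) gap ⟩
    f (suc t + n) Int.* geomInv j (suc (j ∸ suc t))  ≡⟨ cong (Int._*_ (f (suc t + n))) (geomInv-vanishes j-t≤j) ⟩
    f (suc t + n) Int.* Int.0ℤ                       ≡⟨ Intₚ.*-zeroʳ (f (suc t + n)) ⟩
    Int.0ℤ                                           ∎
    where
    gap : suc j + n ∸ (suc t + n) ≡ suc (j ∸ suc t)
    gap = trans (cong₂ _∸_ (+-comm (suc j) n) (+-comm (suc t) n))
                (trans ([m+n]∸[m+o]≡n∸o n (suc j) (suc t)) (+-∸-assoc 1 t<j))
    j-t≤j : suc (j ∸ suc t) ≤ j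
    j-t≤j = subst (_≤ j) (+-∸-assoc 1 t<j) (m∸n≤m j t)

p12-series : ∀ n → (geomInv 0 ⊛ geomInv 1) n ≡ + p12 n
p12-series zero          = refl
p12-series (suc zero)    = refl
p12-series (suc (suc n)) = begin
  (geomInv 0 ⊛ geomInv 1) (2 + n)
    ≡⟨ ⊛-geomInv 1 (geomInv 0) n ⟩
  (geomInv 0 ⊛ geomInv 1) n Int.+ geomInv 0 (2 + n)
    ≡⟨ cong₂ Int._+_ (p12-series n) (guard-yes (1 ∣? (2 + n)) (1∣ (2 + n))) ⟩
  + p12 n Int.+ + 1
    ≡⟨ Intₚ.pos-+ (p12 n) 1 ⟨
  + (p12 n + 1)
    ≡⟨ cong (+_) (+-comm (p12 n) 1) ⟩
  + p12 (2 + n) ∎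

invDen-p124 : ∀ n → invDen n ≡ + p124 n
invDen-p124 0 = refl
invDen-p124 1 = refl
invDen-p124 2 = refl
invDen-p124 3 = refl
invDen-p124 (suc (suc (suc (suc n)))) = begin
  invDen (4 + n)                                         ≡⟨ ⊛-geomInv 3 (geomInv 0 ⊛ geomInv 1) n ⟩
  invDen n Int.+ (geomInv 0 ⊛ geomInv 1) (4 + n)         ≡⟨ cong₂ Int._+_ (invDen-p124 n) (p12-series (4 + n)) ⟩
  + p124 n Int.+ + p12 (4 + n)                           ≡⟨ Intₚ.pos-+ (p124 n) (p12 (4 + n)) ⟨
  + p124 (4 + n)                                         ∎

rhs-coefficient : ∀ s e₁ e₂ t N →
  ((zpow s ⊛ (((zpow 0 ⊕ zpow e₁) ⊕ zpow e₂) ⊖ zpow t)) ⊛ invDen) N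
    ≡ + shift (s + 0) p124 N Int.+ + shift (s + e₁) p124 N Int.+ + shift (s + e₂) p124 N - + shift (s + t) p124 N
rhs-coefficient s e₁ e₂ t N = begin
  ((zpow s ⊛ (((zpow 0 ⊕ zpow e₁) ⊕ zpow e₂) ⊖ zpow t)) ⊛ invDen) N
    ≡⟨ ⊛-congˡ invDen N numerator ⟩
  ((((zpow (s + 0) ⊕ zpow (s + e₁)) ⊕ zpow (s + e₂)) ⊖ zpow (s + t)) ⊛ invDen) N
    ≡⟨ ⊛-distribʳ-⊖ ((zpow (s + 0) ⊕ zpow (s + e₁)) ⊕ zpow (s + e₂)) (zpow (s + t)) invDen N ⟩
  (((zpow (s + 0) ⊕ zpow (s + e₁)) ⊕ zpow (s + e₂)) ⊛ invDen) N - (zpow (s + t) ⊛ invDen) N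
    ≡⟨ cong (_- (zpow (s + t) ⊛ invDen) N)
            (trans (⊛-distribʳ-⊕ (zpow (s + 0) ⊕ zpow (s + e₁)) (zpow (s + e₂)) invDen N)
                   (cong (Int._+ D (s + e₂)) (⊛-distribʳ-⊕ (zpow (s + 0)) (zpow (s + e₁)) invDen N))) ⟩
  D (s + 0) Int.+ D (s + e₁) Int.+ D (s + e₂) - D (s + t)
    ≡⟨ cong₂ _-_ (cong₂ Int._+_ (cong₂ Int._+_ (shifted (s + 0)) (shifted (s + e₁))) (shifted (s + e₂)))
                 (shifted (s + t)) ⟩
  + shift (s + 0) p124 N Int.+ + shift (s + e₁) p124 N Int.+ + shift (s + e₂) p124 N - + shift (s + t) p124 N ∎
  where
  D : ℕ → ℤ
  D x = (zpow x ⊛ invDen) N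
  shifted : ∀ x → D x ≡ + shift x p124 N
  shifted x = zpow-⊛-shift x invDen-p124 N
  numerator : ∀ i → (zpow s ⊛ (((zpow 0 ⊕ zpow e₁) ⊕ zpow e₂) ⊖ zpow t)) i
                  ≡ (((zpow (s + 0) ⊕ zpow (s + e₁)) ⊕ zpow (s + e₂)) ⊖ zpow (s + t)) i
  numerator i = begin
    (zpow s ⊛ (((zpow 0 ⊕ zpow e₁) ⊕ zpow e₂) ⊖ zpow t)) i
      ≡⟨ ⊛-distribˡ-⊖ (zpow s) ((zpow 0 ⊕ zpow e₁) ⊕ zpow e₂) (zpow t) i ⟩
    (zpow s ⊛ ((zpow 0 ⊕ zpow e₁) ⊕ zpow e₂)) i - (zpow s ⊛ zpow t) i
      ≡⟨ cong (_- (zpow s ⊛ zpow t) i)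
              (trans (⊛-distribˡ-⊕ (zpow s) (zpow 0 ⊕ zpow e₁) (zpow e₂) i)
                     (cong (Int._+ (zpow s ⊛ zpow e₂) i) (⊛-distribˡ-⊕ (zpow s) (zpow 0) (zpow e₁) i))) ⟩
    (zpow s ⊛ zpow 0) i Int.+ (zpow s ⊛ zpow e₁) i Int.+ (zpow s ⊛ zpow e₂) i - (zpow s ⊛ zpow t) i
      ≡⟨ cong₂ _-_ (cong₂ Int._+_ (cong₂ Int._+_ (zpow-⊛-zpow s 0 i) (zpow-⊛-zpow s e₁ i))
                                  (zpow-⊛-zpow s e₂ i))
                   (zpow-⊛-zpow s t i) ⟩
    (((zpow (s + 0) ⊕ zpow (s + e₁)) ⊕ zpow (s + e₂)) ⊖ zpow (s + t)) i ∎

pos-transpose : ∀ {l z d₁ d₂ d₃} → l + z ≡ d₁ + d₂ + d₃ → + l ≡ + d₁ Int.+ + d₂ Int.+ + d₃ - + z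
pos-transpose {l} {z} {d₁} {d₂} {d₃} l+z≡ = begin
  + l                             ≡⟨ cancel (+ l) (+ z) ⟨
  + l Int.+ + z - + z             ≡⟨ cong (_- + z) (Intₚ.pos-+ l z) ⟨
  + (l + z) - + z                 ≡⟨ cong (λ m → + m - + z) l+z≡ ⟩
  + (d₁ + d₂ + d₃) - + z
    ≡⟨ cong (_- + z) (trans (Intₚ.pos-+ (d₁ + d₂) d₃) (cong (Int._+ + d₃) (Intₚ.pos-+ d₁ d₂))) ⟩
  + d₁ Int.+ + d₂ Int.+ + d₃ - + z ∎
  where
  cancel : ∀ x y → x Int.+ y - y ≡ x
  cancel = IntSolver.solve-∀

series-identity : ∀ c {x₁ x₂ x₃} s e₁ e₂ t →
  s + 0 ≡ x₁ → s + e₁ ≡ x₂ → s + e₂ ≡ x₃ → s + t ≡ 2 + 2 * c →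
  (∀ N → CentralIdentity c x₁ x₂ x₃ N) →
  ∀ N → + central c N ≡ ((zpow s ⊛ (((zpow 0 ⊕ zpow e₁) ⊕ zpow e₂) ⊖ zpow t)) ⊛ invDen) N
series-identity c s e₁ e₂ t refl refl refl s+t≡ identity N = begin
  + central c N
    ≡⟨ pos-transpose {d₁ = shift (s + 0) p124 N} {shift (s + e₁) p124 N} {shift (s + e₂) p124 N} (identity N) ⟩
  + shift (s + 0) p124 N Int.+ + shift (s + e₁) p124 N Int.+ + shift (s + e₂) p124 N - + shift (2 + 2 * c) p124 N
    ≡⟨ cong (λ x → numerator - + shift x p124 N) s+t≡ ⟨
  + shift (s + 0) p124 N Int.+ + shift (s + e₁) p124 N Int.+ + shift (s + e₂) p124 N - + shift (s + t) p124 N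
    ≡⟨ rhs-coefficient s e₁ e₂ t N ⟨
  ((zpow s ⊛ (((zpow 0 ⊕ zpow e₁) ⊕ zpow e₂) ⊖ zpow t)) ⊛ invDen) N ∎
  where
  numerator : ℤ
  numerator = + shift (s + 0) p124 N Int.+ + shift (s + e₁) p124 N Int.+ + shift (s + e₂) p124 N

proposition2p8 : (a : ℕ) →
      ((N : ℕ) → + p (+ fl3N/2 N - + (3 * a)) 3 N
          ≡ ((zpow (2 * a) ⊛ (((zpow 0 ⊕ zpow 2) ⊕ zpow 3) ⊖ zpow (4 * a + 2))) ⊛ invDen) N)
    × ((N : ℕ) → + p (+ fl3N/2 N - + (3 * a + 1)) 3 N
          ≡ ((zpow (2 * a + 1) ⊛ (((zpow 0 ⊕ zpow 1) ⊕ zpow 3) ⊖ zpow (4 * a + 3))) ⊛ invDen) N)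
    × ((N : ℕ) → + p (+ fl3N/2 N - + (3 * a + 2)) 3 N
          ≡ ((zpow (2 * a + 2) ⊛ (((zpow 0 ⊕ zpow 1) ⊕ zpow 2) ⊖ zpow (4 * a + 4))) ⊛ invDen) N)
proposition2p8 a =
    series-identity (3 * a) (2 * a) 2 3 (4 * a + 2) refl refl refl (exponent₀ a)
      (subst (λ c → ∀ N → CentralIdentity c (2 * a + 0) (2 * a + 2) (2 * a + 3) N) (+-identityʳ (3 * a))
             (identity-iterate 0 0 2 3 identity₀ a))
  , series-identity (3 * a + 1) (2 * a + 1) 1 3 (4 * a + 3)
      (+-identityʳ _) (+-assoc (2 * a) 1 1) (+-assoc (2 * a) 1 3) (exponent₁ a)
      (identity-iterate 1 1 2 4 identity₁ a)
  , series-identity (3 * a + 2) (2 * a + 2) 1 2 (4 * a + 4)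
      (+-identityʳ _) (+-assoc (2 * a) 2 1) (+-assoc (2 * a) 2 2) (exponent₂ a)
      (identity-iterate 2 2 3 4 identity₂ a)
  where
  exponent₀ : ∀ a → 2 * a + (4 * a + 2) ≡ 2 + 2 * (3 * a)
  exponent₀ = solve-∀
  exponent₁ : ∀ a → 2 * a + 1 + (4 * a + 3) ≡ 2 + 2 * (3 * a + 1)
  exponent₁ = solve-∀
  exponent₂ : ∀ a → 2 * a + 2 + (4 * a + 4) ≡ 2 + 2 * (3 * a + 2)
  exponent₂ = solve-∀
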